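{- Let $n\ge 1$, $1\le m\le n$, and $N=\binom{n}{2}+m$, and suppose $m<\frac{n-1}{2}$. Then $C(N)\le \frac{(n-1)(3n-4)}{2}-m+C(N-(n-1))$, where $N-(n-1)=\binom{n-1}{2}+m$ is represented with $n-1$ in place of $n$.
   Context: All graphs are finite and simple. For a graph $G$, $S(G)=\sum_{uv\in E(G)}\min(\deg u,\deg v)$. A vertex is universal if it is adjacent to every other vertex. For an integer $N\ge1$ written uniquely as $N=\binom{n}{2}+m$ with $n\ge 1$, $1\le m\le n$, $C(N)$ denotes the maximum of $S(G)$ over all graphs $G$ with exactly $N$ edges, exactly $n+1$ vertices and no universal vertex (undefined if no such graph exists). -}

module Defs where

open import Data.Nat using (ℕ; zero; suc; _+_; _*_; _∸_; _<_; _<?_; _⊓_)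
open import Data.Bool using (Bool; true; false; if_then_else_; _∧_)
open import Data.Fin using (Fin; toℕ)
open import Data.List using (List; map; allFin)
open import Data.Nat.ListAction using (sum)
open import Relation.Nullary using (¬_)
open import Relation.Nullary.Decidable using (⌊_⌋)
open import Relation.Binary.PropositionalEquality using (_≡_; _≢_)

record Graph (k : ℕ) : Set where
  field
    adj    : Fin k → Fin k → Bool
    sym    : ∀ i j → adj i j ≡ adj j i
    irrefl : ∀ i → adj i i ≡ false
open Graph public

Σv : (k : ℕ) → (Fin k → ℕ) → ℕ
Σv k f = sum (map f (allFin k))

deg : ∀ {k} → Graph k → Fin k → ℕ
deg {k} G i = Σv k (λ j → if adj G i j then 1 else 0)

Σe : ∀ {k} → Graph k → (Fin k → Fin k → ℕ) → ℕ
Σe {k} G w = Σv k (λ i → Σv k (λ j →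
  if ⌊ toℕ i <? toℕ j ⌋ ∧ adj G i j then w i j else 0))

edges : ∀ {k} → Graph k → ℕ
edges G = Σe G (λ _ _ → 1)

S : ∀ {k} → Graph k → ℕ
S G = Σe G (λ i j → deg G i ⊓ deg G j)

Universal : ∀ {k} → Graph k → Fin k → Set
Universal {k} G i = ∀ (j : Fin k) → j ≢ i → adj G i j ≡ true

NoUniversal : ∀ {k} → Graph k → Set
NoUniversal {k} G = ∀ (i : Fin k) → ¬ Universal G i

choose2 : ℕ → ℕ
choose2 zero = 0
choose2 (suc n) = n + choose2 n

-- Admissible graphs in the definition of C(N) for N = choose2 n + m:
-- exactly N edges, exactly n+1 vertices, no universal vertex.
Admissible : (n m : ℕ) → Graph (suc n) → Set
Admissible n m G = edges G ≡ choose2 n + m × NoUniversal G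
  where open import Data.Product using (_×_)

-- Write k = n − 1, so G has k + 2 vertices. With no universal vertex every degree is at most k,
-- and by the handshake lemma the total deficit Σ (k − deg w) is k − 2m > 0. So some vertex v has
-- degree k and a unique non-neighbour u. If deg u < k, take H = G − v; otherwise u is universal in
-- G − v, and H is G − v with an edge uy moved to xy, where deg x < k and x ≁ y. Either way every
-- degree drops by one from G to H except at a pivot z of degree < k, so min(deg i, deg j) drops by
-- one on every edge except the edges zj with deg j > deg z, where it stays. Each neighbour j of z
-- with deg j ≤ deg z, like z itself, has deficit at least k − deg z ≥ 1, so there are at most
-- deg z − 2m of them: at least 2m edges at z keep their minimum, which gives the bound.

module Submission where

open import Defs renaming (sym to adj-sym; irrefl to adj-irrefl)
open import Data.Nat using (ℕ; zero; suc; _+_; _*_; _∸_; _≤_; _<_; _⊓_; z≤n; s≤s; _<?_; _≤ᵇ_; >-nonZero)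
open import Data.Nat.Properties
open import Data.Nat.ListAction using () renaming (sum to sumˡ)
open import Data.Bool using (Bool; true; false; if_then_else_; _∧_; _∨_)
open import Data.Bool.Properties using (¬-not; ∧-comm; ∨-comm; ∨-identityʳ) renaming (_≟_ to _≟ᵇ_)
open import Data.Fin using (Fin; zero; suc; punchIn; punchOut; toℕ)
open import Data.Fin.Properties
  using (punchInᵢ≢i; punchIn-injective; punchIn-punchOut; toℕ-injective; any?) renaming (_≟_ to _≟ᶠ_)
open import Data.List using (tabulate)
open import Data.List.Properties using (map-tabulate)
open import Data.Product using (Σ; _×_; _,_; proj₂)
open import Data.Sum using (_⊎_; inj₁; inj₂)
open import Data.Empty using (⊥; ⊥-elim)
open import Function using (case_of_; _∘_)
open import Relation.Nullary using (¬_; ¬?; yes; no; does)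
open import Relation.Nullary.Reflects using (ofʸ; ofⁿ)
open import Relation.Nullary.Decidable using (⌊_⌋; _×-dec_)
open import Relation.Binary.PropositionalEquality
open import Data.Nat.Tactic.RingSolver using (solve-∀)
open import Algebra.Properties.CommutativeMonoid.Sum +-0-commutativeMonoid
  using (sum-syntax; sum-cong-≗; sum-remove; sum-replicate-zero; ∑-distrib-+; ∑-comm)

𝟙 : Bool → ℕ
𝟙 b = if b then 1 else 0

pick : ∀ {k} → Fin k → Fin k → ℕ → ℕ
pick a i c = if does (i ≟ᶠ a) then c else 0

δ : ∀ {k} → Fin k → Fin k → ℕ
δ a i = pick a i 1

Σv≡∑ : ∀ k (f : Fin k → ℕ) → Σv k f ≡ ∑[ i < k ] f i
Σv≡∑ k f = trans (cong sumˡ (map-tabulate (λ i → i) f)) (sum-tabulate k f)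
  where
  sum-tabulate : ∀ k (f : Fin k → ℕ) → sumˡ (tabulate f) ≡ ∑[ i < k ] f i
  sum-tabulate zero    f = refl
  sum-tabulate (suc k) f = cong (f zero +_) (sum-tabulate k (λ i → f (suc i)))

∑-mono-≤ : ∀ {k} {f g : Fin k → ℕ} → (∀ i → f i ≤ g i) → ∑[ i < k ] f i ≤ ∑[ i < k ] g i
∑-mono-≤ {zero}  f≤g = z≤n
∑-mono-≤ {suc k} f≤g = +-mono-≤ (f≤g zero) (∑-mono-≤ (λ i → f≤g (suc i)))

∑-const : ∀ k c → ∑[ i < k ] c ≡ k * c
∑-const zero    c = refl
∑-const (suc k) c = cong (c +_) (∑-const k c)

∑-*ˡ : ∀ {k} c (f : Fin k → ℕ) → ∑[ i < k ] (c * f i) ≡ c * ∑[ i < k ] f i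
∑-*ˡ {zero}  c f = sym (*-zeroʳ c)
∑-*ˡ {suc k} c f = trans (cong (c * f zero +_) (∑-*ˡ c (λ i → f (suc i))))
                         (sym (*-distribˡ-+ c (f zero) _))

∑-pick : ∀ {k} (b : Fin k) (f : Fin k → ℕ) → ∑[ j < k ] pick b j (f j) ≡ f b
∑-pick {suc k} zero    f = trans (cong (f zero +_) (sum-replicate-zero k)) (+-identityʳ _)
∑-pick {suc k} (suc b) f = ∑-pick {k} b (λ j → f (suc j))

pick-self : ∀ {k} (a : Fin k) c → pick a a c ≡ c
pick-self a c with a ≟ᶠ a
... | yes _   = refl
... | no a≢a = ⊥-elim (a≢a refl)

pick-≢ : ∀ {k} {a i : Fin k} c → i ≢ a → pick a i c ≡ 0
pick-≢ {a = a} {i} c i≢a with i ≟ᶠ a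
... | yes i≡a = ⊥-elim (i≢a i≡a)
... | no _    = refl

∑-δ : ∀ {k} (b : Fin k) → ∑[ j < k ] δ b j ≡ 1
∑-δ b = ∑-pick b (λ _ → 1)

nbrSum : ∀ {k} → Graph k → Fin k → (Fin k → ℕ) → ℕ
nbrSum {k} G i f = ∑[ j < k ] (if adj G i j then f j else 0)

arcSum : ∀ {k} → Graph k → (Fin k → Fin k → ℕ) → ℕ
arcSum {k} G w = ∑[ i < k ] nbrSum G i (w i)

module _ {k : ℕ} (G : Graph k) where

  adj⇒≢ : ∀ {i j} → adj G i j ≡ true → i ≢ j
  adj⇒≢ {i} i~j refl with trans (sym i~j) (adj-irrefl G i)
  ... | ()

  deg≡nbrSum : ∀ i → deg G i ≡ nbrSum G i (λ _ → 1)
  deg≡nbrSum i = Σv≡∑ k _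

  nbrSum-zero : ∀ i → nbrSum G i (λ _ → 0) ≡ 0
  nbrSum-zero i = trans (sum-cong-≗ zero-if) (sum-replicate-zero k)
    where
    zero-if : ∀ j → (if adj G i j then 0 else 0) ≡ 0
    zero-if j with adj G i j
    ... | true  = refl
    ... | false = refl

  nbrSum-+ : ∀ i (f g : Fin k → ℕ) → nbrSum G i (λ j → f j + g j) ≡ nbrSum G i f + nbrSum G i g
  nbrSum-+ i f g = trans (sum-cong-≗ split)
    (∑-distrib-+ (λ j → if adj G i j then f j else 0) (λ j → if adj G i j then g j else 0))
    where
    split : ∀ j → (if adj G i j then f j + g j else 0) ≡ (if adj G i j then f j else 0) + (if adj G i j then g j else 0)
    split j with adj G i j
    ... | true  = refl
    ... | false = refl

  nbrSum-mono : ∀ i {f g : Fin k → ℕ} → (∀ j → adj G i j ≡ true → f j ≤ g j) → nbrSum G i f ≤ nbrSum G i g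
  nbrSum-mono i {f} {g} f≤g = ∑-mono-≤ pointwise
    where
    pointwise : ∀ j → (if adj G i j then f j else 0) ≤ (if adj G i j then g j else 0)
    pointwise j with adj G i j in eq
    ... | true  = f≤g j eq
    ... | false = z≤n

  arcSum-+ : ∀ (v w : Fin k → Fin k → ℕ) → arcSum G (λ i j → v i j + w i j) ≡ arcSum G v + arcSum G w
  arcSum-+ v w = trans (sum-cong-≗ (λ i → nbrSum-+ i (v i) (w i)))
    (∑-distrib-+ (λ i → nbrSum G i (v i)) (λ i → nbrSum G i (w i)))

  arcSum-mono : ∀ {v w : Fin k → Fin k → ℕ} → (∀ i j → adj G i j ≡ true → v i j ≤ w i j) →
                arcSum G v ≤ arcSum G w
  arcSum-mono v≤w = ∑-mono-≤ (λ i → nbrSum-mono i (v≤w i))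

  arcSum-transpose : ∀ (w : Fin k → Fin k → ℕ) → arcSum G w ≡ arcSum G (λ i j → w j i)
  arcSum-transpose w = trans (∑-comm (λ i j → if adj G i j then w i j else 0))
    (sum-cong-≗ (λ i → sum-cong-≗ (λ j → cong (λ b → if b then w j i else 0) (adj-sym G j i))))

  arcSum-row : ∀ z (g : Fin k → ℕ) → arcSum G (λ i j → pick z i (g j)) ≡ nbrSum G z g
  arcSum-row z g = trans (sum-cong-≗ row) (∑-pick z (λ i → nbrSum G i g))
    where
    row : ∀ i → nbrSum G i (λ j → pick z i (g j)) ≡ pick z i (nbrSum G i g)
    row i with does (i ≟ᶠ z)
    ... | true  = refl
    ... | false = nbrSum-zero i

  arcSum-column : ∀ z (g : Fin k → ℕ) → arcSum G (λ i j → pick z j (g i)) ≡ nbrSum G z g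
  arcSum-column z g = trans (arcSum-transpose _) (arcSum-row z g)

  arcSum-double : ∀ (w : Fin k → Fin k → ℕ) → (∀ i j → w i j ≡ w j i) → 2 * Σe G w ≡ arcSum G w
  arcSum-double w w-sym = begin
    2 * Σe G w                                                ≡⟨ cong (2 *_) Σe≡∑∑ ⟩
    2 * ∑[ i < k ] ∑[ j < k ] E i j                           ≡⟨ cong (∑[ i < k ] ∑[ j < k ] E i j +_) (+-identityʳ _) ⟩
    ∑[ i < k ] ∑[ j < k ] E i j + ∑[ i < k ] ∑[ j < k ] E i j ≡⟨ cong (∑[ i < k ] ∑[ j < k ] E i j +_) (∑-comm E) ⟩
    ∑[ i < k ] ∑[ j < k ] E i j + ∑[ i < k ] ∑[ j < k ] E j i ≡⟨ sym (∑-distrib-+ (λ i → ∑[ j < k ] E i j) _) ⟩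
    ∑[ i < k ] (∑[ j < k ] E i j + ∑[ j < k ] E j i)          ≡⟨ sum-cong-≗ (λ i → sym (∑-distrib-+ (E i) (λ j → E j i))) ⟩
    ∑[ i < k ] ∑[ j < k ] (E i j + E j i)                     ≡⟨ sum-cong-≗ (λ i → sum-cong-≗ (E-+-Eᵀ i)) ⟩
    arcSum G w                                                ∎
    where
    open ≡-Reasoning
    E : Fin k → Fin k → ℕ
    E i j = if ⌊ toℕ i <? toℕ j ⌋ ∧ adj G i j then w i j else 0
    Σe≡∑∑ : Σe G w ≡ ∑[ i < k ] ∑[ j < k ] E i j
    Σe≡∑∑ = trans (Σv≡∑ k _) (sum-cong-≗ (λ i → Σv≡∑ k (E i)))
    E-+-Eᵀ : ∀ i j → E i j + E j i ≡ (if adj G i j then w i j else 0)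
    E-+-Eᵀ i j rewrite adj-sym G j i | w-sym j i with toℕ i <? toℕ j | toℕ j <? toℕ i | adj G i j in i~j
    ... | yes i<j | yes j<i | _     = ⊥-elim (<-asym i<j j<i)
    ... | yes _   | no _    | true  = +-identityʳ _
    ... | yes _   | no _    | false = refl
    ... | no _    | yes _   | true  = refl
    ... | no _    | yes _   | false = refl
    ... | no i≮j  | no j≮i  | true  = ⊥-elim (adj⇒≢ i~j (toℕ-injective (≤-antisym (≮⇒≥ j≮i) (≮⇒≥ i≮j))))
    ... | no _    | no _    | false = refl

  handshake : 2 * edges G ≡ ∑[ i < k ] deg G i
  handshake = trans (arcSum-double (λ _ _ → 1) (λ _ _ → refl)) (sum-cong-≗ (λ i → sym (deg≡nbrSum i)))

  S-double : 2 * S G ≡ arcSum G (λ i j → deg G i ⊓ deg G j)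
  S-double = arcSum-double _ (λ i j → ⊓-comm (deg G i) (deg G j))

  deg-+-∑-≤ : ∀ i (c : Fin k → ℕ) → (∀ j → 𝟙 (adj G i j) + c j ≤ 1) → deg G i + ∑[ j < k ] c j ≤ k
  deg-+-∑-≤ i c bound = begin
    deg G i + ∑[ j < k ] c j                       ≡⟨ cong (_+ ∑[ j < k ] c j) (Σv≡∑ k _) ⟩
    ∑[ j < k ] 𝟙 (adj G i j) + ∑[ j < k ] c j      ≡⟨ sym (∑-distrib-+ (λ j → 𝟙 (adj G i j)) c) ⟩
    ∑[ j < k ] (𝟙 (adj G i j) + c j)               ≤⟨ ∑-mono-≤ bound ⟩
    ∑[ j < k ] 1                                   ≡⟨ trans (∑-const k 1) (*-identityʳ k) ⟩
    k                                              ∎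
    where open ≤-Reasoning

  nonAdj⇒deg+2≤ : ∀ {i j} → j ≢ i → adj G i j ≡ false → deg G i + 2 ≤ k
  nonAdj⇒deg+2≤ {i} {j} j≢i i≁j = subst (λ c → deg G i + c ≤ k) two (deg-+-∑-≤ i _ bound)
    where
    two : ∑[ w < k ] (δ i w + δ j w) ≡ 2
    two = trans (∑-distrib-+ (δ i) (δ j)) (cong₂ _+_ (∑-δ i) (∑-δ j))
    bound : ∀ w → 𝟙 (adj G i w) + (δ i w + δ j w) ≤ 1
    bound w with w ≟ᶠ i | w ≟ᶠ j
    ... | yes refl | yes refl = ⊥-elim (j≢i refl)
    ... | yes refl | no _     rewrite adj-irrefl G w = s≤s z≤n
    ... | no _     | yes refl rewrite i≁j = s≤s z≤n
    ... | no _     | no _     with adj G i w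
    ...   | true  = s≤s z≤n
    ...   | false = z≤n

  deg+2≡⇒uniqueNonAdj : ∀ {i j l} → j ≢ i → adj G i j ≡ false → deg G i + 2 ≡ k →
                         l ≢ i → l ≢ j → adj G i l ≡ true
  deg+2≡⇒uniqueNonAdj {i} {j} {l} j≢i i≁j deg≡ l≢i l≢j with adj G i l in i?l
  ... | true  = refl
  ... | false = ⊥-elim (<-irrefl deg≡ (subst (_≤ k) (+-suc (deg G i) 2)
                         (subst (λ c → deg G i + c ≤ k) three (deg-+-∑-≤ i _ bound))))
    where
    three : ∑[ w < k ] (δ i w + (δ j w + δ l w)) ≡ 3
    three = trans (∑-distrib-+ (δ i) _) (cong₂ _+_ (∑-δ i)
              (trans (∑-distrib-+ (δ j) (δ l)) (cong₂ _+_ (∑-δ j) (∑-δ l))))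
    bound : ∀ w → 𝟙 (adj G i w) + (δ i w + (δ j w + δ l w)) ≤ 1
    bound w with w ≟ᶠ i | w ≟ᶠ j | w ≟ᶠ l
    ... | yes refl | yes refl | _        = ⊥-elim (j≢i refl)
    ... | yes refl | _        | yes refl = ⊥-elim (l≢i refl)
    ... | _        | yes refl | yes refl = ⊥-elim (l≢j refl)
    ... | yes refl | no _     | no _     rewrite adj-irrefl G w = s≤s z≤n
    ... | no _     | yes refl | no _     rewrite i≁j = s≤s z≤n
    ... | no _     | no _     | yes refl rewrite i?l = s≤s z≤n
    ... | no _     | no _     | no _     with adj G i w
    ...   | true  = s≤s z≤n
    ...   | false = z≤n

  universal⇒k≤deg+1 : ∀ {i} → Universal G i → k ≤ deg G i + 1
  universal⇒k≤deg+1 {i} univ = begin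
    k                                          ≡⟨ sym (trans (∑-const k 1) (*-identityʳ k)) ⟩
    ∑[ j < k ] 1                               ≤⟨ ∑-mono-≤ bound ⟩
    ∑[ j < k ] (𝟙 (adj G i j) + δ i j)         ≡⟨ ∑-distrib-+ (λ j → 𝟙 (adj G i j)) (δ i) ⟩
    ∑[ j < k ] 𝟙 (adj G i j) + ∑[ j < k ] δ i j ≡⟨ cong₂ _+_ (sym (Σv≡∑ k _)) (∑-δ i) ⟩
    deg G i + 1                                ∎
    where
    open ≤-Reasoning
    bound : ∀ j → 1 ≤ 𝟙 (adj G i j) + δ i j
    bound j with j ≟ᶠ i
    ... | yes refl = m≤n+m 1 _
    ... | no j≢i   rewrite univ j j≢i = s≤s z≤n

  nonUniversal⇒nonAdj : ∀ {i} → ¬ Universal G i → Σ (Fin k) λ j → j ≢ i × adj G i j ≡ false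
  nonUniversal⇒nonAdj {i} ¬univ with any? (λ j → ¬? (j ≟ᶠ i) ×-dec (adj G i j ≟ᵇ false))
  ... | yes found = found
  ... | no none   = ⊥-elim (¬univ (λ j j≢i → ¬-not (λ i≁j → none (j , j≢i , i≁j))))

  nbrSum-+-nonAdj : ∀ {u v} (f : Fin k → ℕ) → u ≢ v → adj G v u ≡ false → nbrSum G v f + f u + f v ≤ ∑[ j < k ] f j
  nbrSum-+-nonAdj {u} {v} f u≢v v≁u = begin
    nbrSum G v f + f u + f v
      ≡⟨ sym (cong₂ (λ a b → nbrSum G v f + a + b) (∑-pick u f) (∑-pick v f)) ⟩
    nbrSum G v f + ∑[ j < k ] pick u j (f j) + ∑[ j < k ] pick v j (f j)
      ≡⟨ cong (_+ ∑[ j < k ] pick v j (f j))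
              (sym (∑-distrib-+ (λ j → if adj G v j then f j else 0) (λ j → pick u j (f j)))) ⟩
    ∑[ j < k ] ((if adj G v j then f j else 0) + pick u j (f j)) + ∑[ j < k ] pick v j (f j)
      ≡⟨ sym (∑-distrib-+ (λ j → (if adj G v j then f j else 0) + pick u j (f j)) (λ j → pick v j (f j))) ⟩
    ∑[ j < k ] ((if adj G v j then f j else 0) + pick u j (f j) + pick v j (f j))
      ≤⟨ ∑-mono-≤ bound ⟩
    ∑[ j < k ] f j ∎
    where
    open ≤-Reasoning
    bound : ∀ j → (if adj G v j then f j else 0) + pick u j (f j) + pick v j (f j) ≤ f j
    bound j with j ≟ᶠ u | j ≟ᶠ v
    ... | yes refl | yes refl = ⊥-elim (u≢v refl)
    ... | yes refl | no _     rewrite v≁u = ≤-reflexive (+-identityʳ (f j))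
    ... | no _     | yes refl rewrite adj-irrefl G j = ≤-refl
    ... | no _     | no _     with adj G v j
    ...   | true  = ≤-reflexive (trans (+-identityʳ _) (+-identityʳ (f j)))
    ...   | false = z≤n

nbrsAtMost : ∀ {k} → Graph k → (Fin k → ℕ) → Fin k → ℕ
nbrsAtMost G d z = nbrSum G z (λ j → 𝟙 (d j ≤ᵇ d z))

nbrsAtMost-deficit : ∀ {n} (G : Graph n) (d : Fin n → ℕ) k z →
  (k ∸ d z) * (1 + nbrsAtMost G d z) ≤ ∑[ w < n ] (k ∸ d w)
nbrsAtMost-deficit {n} G d k z = begin
  s * (1 + nbrsAtMost G d z)                           ≡⟨ cong (λ c → s * (c + nbrsAtMost G d z)) (sym (∑-δ z)) ⟩
  s * (∑[ w < n ] δ z w + nbrsAtMost G d z)            ≡⟨ cong (s *_) (sym (∑-distrib-+ (δ z) _)) ⟩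
  s * ∑[ w < n ] (δ z w + below w)                     ≡⟨ sym (∑-*ˡ s (λ w → δ z w + below w)) ⟩
  ∑[ w < n ] (s * (δ z w + below w))                   ≤⟨ ∑-mono-≤ pointwise ⟩
  ∑[ w < n ] (k ∸ d w)                                 ∎
  where
  open ≤-Reasoning
  s : ℕ
  s = k ∸ d z
  below : Fin n → ℕ
  below w = if adj G z w then 𝟙 (d w ≤ᵇ d z) else 0
  pointwise : ∀ w → s * (δ z w + below w) ≤ k ∸ d w
  pointwise w with w ≟ᶠ z
  ... | yes refl rewrite adj-irrefl G w = ≤-reflexive (*-identityʳ s)
  ... | no _ with adj G z w
  ...   | false = subst (_≤ k ∸ d w) (sym (*-zeroʳ s)) z≤n
  ...   | true with d w ≤ᵇ d z | ≤ᵇ-reflects-≤ (d w) (d z)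
  ...     | true  | ofʸ dw≤dz = subst (_≤ k ∸ d w) (sym (*-identityʳ s)) (∸-monoʳ-≤ k dw≤dz)
  ...     | false | ofⁿ _     = subst (_≤ k ∸ d w) (sym (*-zeroʳ s)) z≤n

deg<⇒noUniversal : ∀ {k} (H : Graph (suc k)) → (∀ w → deg H w < k) → NoUniversal H
deg<⇒noUniversal {k} H deg< w univ =
  <⇒≱ (deg< w) (+-cancelʳ-≤ 1 k (deg H w) (subst (_≤ deg H w + 1) (+-comm 1 k) (universal⇒k≤deg+1 H univ)))

removeVertex : ∀ {k} → Graph (suc k) → Fin (suc k) → Graph k
removeVertex G v = record
  { adj    = λ i j → adj G (punchIn v i) (punchIn v j)
  ; sym    = λ i j → adj-sym G (punchIn v i) (punchIn v j)
  ; irrefl = λ i → adj-irrefl G (punchIn v i)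
  }

module _ {k : ℕ} (G : Graph (suc k)) (v : Fin (suc k)) where

  private
    p : Fin k → Fin (suc k)
    p = punchIn v

  nbrSum-removeVertex : ∀ i (f : Fin (suc k) → ℕ) →
    nbrSum G (p i) f ≡ (if adj G (p i) v then f v else 0) + nbrSum (removeVertex G v) i (λ j → f (p j))
  nbrSum-removeVertex i f = sum-remove {i = v} (λ j → if adj G (p i) j then f j else 0)

  nbrSum-removeVertex-≤ : ∀ i (f : Fin (suc k) → ℕ) → nbrSum (removeVertex G v) i (λ j → f (p j)) ≤ nbrSum G (p i) f
  nbrSum-removeVertex-≤ i f =
    subst (nbrSum (removeVertex G v) i (λ j → f (p j)) ≤_) (sym (nbrSum-removeVertex i f)) (m≤n+m _ _)

  nbrSum-punchIn : ∀ (f : Fin (suc k) → ℕ) → nbrSum G v f ≡ ∑[ i < k ] (if adj G v (p i) then f (p i) else 0)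
  nbrSum-punchIn f rewrite sum-remove {i = v} (λ j → if adj G v j then f j else 0) | adj-irrefl G v = refl

  deg-removeVertex : ∀ i → deg G (p i) ≡ 𝟙 (adj G (p i) v) + deg (removeVertex G v) i
  deg-removeVertex i = begin
    deg G (p i)
      ≡⟨ deg≡nbrSum G (p i) ⟩
    nbrSum G (p i) (λ _ → 1)
      ≡⟨ nbrSum-removeVertex i _ ⟩
    𝟙 (adj G (p i) v) + nbrSum (removeVertex G v) i (λ _ → 1)
      ≡⟨ cong (𝟙 (adj G (p i) v) +_) (sym (deg≡nbrSum (removeVertex G v) i)) ⟩
    𝟙 (adj G (p i) v) + deg (removeVertex G v) i ∎
    where open ≡-Reasoning

  arcSum-removeVertex : ∀ (w : Fin (suc k) → Fin (suc k) → ℕ) → (∀ i j → w i j ≡ w j i) →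
    arcSum G w ≡ 2 * nbrSum G v (w v) + arcSum (removeVertex G v) (λ i j → w (p i) (p j))
  arcSum-removeVertex w w-sym = begin
    arcSum G w
      ≡⟨ sum-remove {i = v} (λ i → nbrSum G i (w i)) ⟩
    R + ∑[ i < k ] nbrSum G (p i) (w (p i))
      ≡⟨ cong (R +_) (sum-cong-≗ (λ i → nbrSum-removeVertex i (w (p i)))) ⟩
    R + ∑[ i < k ] (toV i + nbrSum G′ i (λ j → w (p i) (p j)))
      ≡⟨ cong (R +_) (∑-distrib-+ toV (λ i → nbrSum G′ i (λ j → w (p i) (p j)))) ⟩
    R + (∑[ i < k ] toV i + Q)
      ≡⟨ cong (λ r → R + (r + Q)) (trans (sum-cong-≗ toV≡fromV) (sym (nbrSum-punchIn (w v)))) ⟩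
    R + (R + Q)
      ≡⟨ sym (+-assoc R R Q) ⟩
    R + R + Q
      ≡⟨ cong (λ r → R + r + Q) (sym (+-identityʳ R)) ⟩
    2 * R + Q ∎
    where
    open ≡-Reasoning
    G′ : Graph k
    G′ = removeVertex G v
    R : ℕ
    R = nbrSum G v (w v)
    Q : ℕ
    Q = arcSum G′ (λ i j → w (p i) (p j))
    toV : Fin k → ℕ
    toV i = if adj G (p i) v then w (p i) v else 0
    toV≡fromV : ∀ i → toV i ≡ (if adj G v (p i) then w v (p i) else 0)
    toV≡fromV i rewrite adj-sym G (p i) v | w-sym (p i) v = refl

isPair : ∀ {n} → Fin n → Fin n → Fin n → Fin n → Bool
isPair a b i j = does (i ≟ᶠ a) ∧ does (j ≟ᶠ b) ∨ does (i ≟ᶠ b) ∧ does (j ≟ᶠ a)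

module _ {n : ℕ} where

  isPair-sym : ∀ (a b i j : Fin n) → isPair a b i j ≡ isPair a b j i
  isPair-sym a b i j rewrite ∧-comm (does (i ≟ᶠ a)) (does (j ≟ᶠ b)) | ∧-comm (does (i ≟ᶠ b)) (does (j ≟ᶠ a)) =
    ∨-comm (does (j ≟ᶠ b) ∧ does (i ≟ᶠ a)) _

  isPair-true : ∀ {a b i j : Fin n} → isPair a b i j ≡ true → (i ≡ a × j ≡ b) ⊎ (i ≡ b × j ≡ a)
  isPair-true {a} {b} {i} {j} eq with i ≟ᶠ a | j ≟ᶠ b | i ≟ᶠ b | j ≟ᶠ a
  ... | yes i≡a | yes j≡b | _       | _       = inj₁ (i≡a , j≡b)
  ... | _       | _       | yes i≡b | yes j≡a = inj₂ (i≡b , j≡a)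
  ... | yes _   | no _    | yes _   | no _    = case eq of λ ()
  ... | yes _   | no _    | no _    | _       = case eq of λ ()
  ... | no _    | _       | yes _   | no _    = case eq of λ ()
  ... | no _    | _       | no _    | _       = case eq of λ ()

  isPair-false : ∀ {a b i j : Fin n} → ¬ ((i ≡ a × j ≡ b) ⊎ (i ≡ b × j ≡ a)) → isPair a b i j ≡ false
  isPair-false {a} {b} {i} {j} ¬pair with isPair a b i j in eq
  ... | true  = ⊥-elim (¬pair (isPair-true eq))
  ... | false = refl

  ∑-isPair : ∀ {a b : Fin n} → a ≢ b → ∀ i (f : Fin n → ℕ) →
    ∑[ j < n ] (if isPair a b i j then f j else 0) ≡ pick a i (f b) + pick b i (f a)
  ∑-isPair {a} {b} a≢b i f with i ≟ᶠ a | i ≟ᶠ b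
  ... | yes refl | yes refl = ⊥-elim (a≢b refl)
  ... | yes refl | no _     = trans (sum-cong-≗ (λ j → cong (λ c → if c then f j else 0) (∨-identityʳ _)))
                                    (trans (∑-pick b f) (sym (+-identityʳ (f b))))
  ... | no _     | yes refl = ∑-pick a f
  ... | no _     | no _     = sum-replicate-zero n

  adj-isPair : ∀ (H : Graph n) {a b i j β} → adj H a b ≡ β → isPair a b i j ≡ true → adj H i j ≡ β
  adj-isPair H {a} {b} {i} {j} a~b pair with isPair-true {a} {b} {i} {j} pair
  ... | inj₁ (refl , refl) = a~b
  ... | inj₂ (refl , refl) = trans (adj-sym H _ _) a~b

rotateEdge : ∀ {n} (H : Graph n) (y u x : Fin n) → x ≢ y → Graph n
rotateEdge {n} H y u x x≢y = record
  { adj    = adj′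
  ; sym    = λ i j → begin
      adj′ i j ≡⟨ cong₂ (λ p q → if p then true else if q then false else adj H i j)
                        (isPair-sym x y i j) (isPair-sym u y i j) ⟩
      (if isPair x y j i then true else if isPair u y j i then false else adj H i j)
               ≡⟨ cong (λ b → if isPair x y j i then true else if isPair u y j i then false else b) (adj-sym H i j) ⟩
      adj′ j i ∎
  ; irrefl = irrefl′
  }
  where
  open ≡-Reasoning
  adj′ : Fin n → Fin n → Bool
  adj′ i j = if isPair x y i j then true else if isPair u y i j then false else adj H i j
  irrefl′ : ∀ i → adj′ i i ≡ false
  irrefl′ i rewrite isPair-false {a = x} {y} {i} {i} (λ { (inj₁ (refl , refl)) → x≢y refl
                                                          ; (inj₂ (refl , refl)) → x≢y refl })
    with isPair u y i i
  ... | true  = refl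
  ... | false = adj-irrefl H i

module _ {n : ℕ} (H : Graph n) {y u x : Fin n} (x≢y : x ≢ y) (x≢u : x ≢ u)
         (u~y : adj H u y ≡ true) (x≁y : adj H x y ≡ false) where

  private
    H′ : Graph n
    H′ = rotateEdge H y u x x≢y

    u≢y : u ≢ y
    u≢y = adj⇒≢ H u~y

    disjoint : ∀ {i j} → isPair x y i j ≡ true → isPair u y i j ≡ true → ⊥
    disjoint {i} {j} xy uy with isPair-true {a = x} {y} {i} {j} xy | isPair-true {a = u} {y} {i} {j} uy
    ... | inj₁ (i≡x , _)   | inj₁ (i≡u , _)   = x≢u (trans (sym i≡x) i≡u)
    ... | inj₁ (i≡x , _)   | inj₂ (i≡y , _)   = x≢y (trans (sym i≡x) i≡y)
    ... | inj₂ (_ , j≡x)   | inj₁ (_ , j≡y)   = x≢y (trans (sym j≡x) j≡y)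
    ... | inj₂ (_ , j≡x)   | inj₂ (_ , j≡u)   = x≢u (trans (sym j≡x) j≡u)

    pointwise : ∀ i j c → (if adj H′ i j then c else 0) + (if isPair u y i j then c else 0)
                        ≡ (if adj H i j then c else 0) + (if isPair x y i j then c else 0)
    pointwise i j c with isPair x y i j in xy | isPair u y i j in uy
    ... | true  | true  = ⊥-elim (disjoint {i} {j} xy uy)
    ... | true  | false rewrite adj-isPair H {x} {y} {i} {j} x≁y xy = +-identityʳ c
    ... | false | true  rewrite adj-isPair H {u} {y} {i} {j} u~y uy = sym (+-identityʳ c)
    ... | false | false = refl

  rotateEdge-nbrSum : ∀ i (f : Fin n → ℕ) →
    nbrSum H′ i f + (pick u i (f y) + pick y i (f u)) ≡ nbrSum H i f + (pick x i (f y) + pick y i (f x))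
  rotateEdge-nbrSum i f = begin
    nbrSum H′ i f + (pick u i (f y) + pick y i (f u))
      ≡⟨ cong (nbrSum H′ i f +_) (sym (∑-isPair u≢y i f)) ⟩
    nbrSum H′ i f + ∑[ j < n ] (if isPair u y i j then f j else 0)
      ≡⟨ sym (∑-distrib-+ (λ j → if adj H′ i j then f j else 0) _) ⟩
    ∑[ j < n ] ((if adj H′ i j then f j else 0) + (if isPair u y i j then f j else 0))
      ≡⟨ sum-cong-≗ (λ j → pointwise i j (f j)) ⟩
    ∑[ j < n ] ((if adj H i j then f j else 0) + (if isPair x y i j then f j else 0))
      ≡⟨ ∑-distrib-+ (λ j → if adj H i j then f j else 0) _ ⟩
    nbrSum H i f + ∑[ j < n ] (if isPair x y i j then f j else 0)
      ≡⟨ cong (nbrSum H i f +_) (∑-isPair x≢y i f) ⟩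
    nbrSum H i f + (pick x i (f y) + pick y i (f x)) ∎
    where open ≡-Reasoning

  rotateEdge-deg : ∀ i → deg H′ i + δ u i ≡ deg H i + δ x i
  rotateEdge-deg i = +-cancelʳ-≡ (δ y i) _ _ (begin
    deg H′ i + δ u i + δ y i             ≡⟨ +-assoc (deg H′ i) _ _ ⟩
    deg H′ i + (δ u i + δ y i)           ≡⟨ cong (_+ (δ u i + δ y i)) (deg≡nbrSum H′ i) ⟩
    nbrSum H′ i (λ _ → 1) + (δ u i + δ y i) ≡⟨ rotateEdge-nbrSum i (λ _ → 1) ⟩
    nbrSum H i (λ _ → 1) + (δ x i + δ y i)  ≡⟨ cong (_+ (δ x i + δ y i)) (sym (deg≡nbrSum H i)) ⟩
    deg H i + (δ x i + δ y i)            ≡⟨ sym (+-assoc (deg H i) _ _) ⟩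
    deg H i + δ x i + δ y i              ∎)
    where open ≡-Reasoning

  rotateEdge-nbrSum-pivot : ∀ (f : Fin n → ℕ) → nbrSum H′ x f ≡ nbrSum H x f + f y
  rotateEdge-nbrSum-pivot f = begin
    nbrSum H′ x f
      ≡⟨ sym (+-identityʳ _) ⟩
    nbrSum H′ x f + (0 + 0)
      ≡⟨ cong (nbrSum H′ x f +_) (sym (cong₂ _+_ (pick-≢ (f y) x≢u) (pick-≢ (f u) x≢y))) ⟩
    nbrSum H′ x f + (pick u x (f y) + pick y x (f u))
      ≡⟨ rotateEdge-nbrSum x f ⟩
    nbrSum H x f + (pick x x (f y) + pick y x (f x))
      ≡⟨ cong (nbrSum H x f +_) (cong₂ _+_ (pick-self x (f y)) (pick-≢ (f x) x≢y)) ⟩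
    nbrSum H x f + (f y + 0)
      ≡⟨ cong (nbrSum H x f +_) (+-identityʳ (f y)) ⟩
    nbrSum H x f + f y ∎
    where open ≡-Reasoning

  rotateEdge-arcSum : ∀ (w : Fin n → Fin n → ℕ) → arcSum H′ w + (w u y + w y u) ≡ arcSum H w + (w x y + w y x)
  rotateEdge-arcSum w = begin
    arcSum H′ w + (w u y + w y u)
      ≡⟨ cong (arcSum H′ w +_) (sym (picks u y)) ⟩
    arcSum H′ w + ∑[ i < n ] (pick u i (w i y) + pick y i (w i u))
      ≡⟨ sym (∑-distrib-+ (λ i → nbrSum H′ i (w i)) _) ⟩
    ∑[ i < n ] (nbrSum H′ i (w i) + (pick u i (w i y) + pick y i (w i u)))
      ≡⟨ sum-cong-≗ (λ i → rotateEdge-nbrSum i (w i)) ⟩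
    ∑[ i < n ] (nbrSum H i (w i) + (pick x i (w i y) + pick y i (w i x)))
      ≡⟨ ∑-distrib-+ (λ i → nbrSum H i (w i)) _ ⟩
    arcSum H w + ∑[ i < n ] (pick x i (w i y) + pick y i (w i x))
      ≡⟨ cong (arcSum H w +_) (picks x y) ⟩
    arcSum H w + (w x y + w y x) ∎
    where
    open ≡-Reasoning
    picks : ∀ a b → ∑[ i < n ] (pick a i (w i b) + pick b i (w i a)) ≡ w a b + w b a
    picks a b = trans (∑-distrib-+ (λ i → pick a i (w i b)) _)
                      (cong₂ _+_ (∑-pick a (λ i → w i b)) (∑-pick b (λ i → w i a)))

a⊓[b+1]≤a⊓b+𝟙[b+1≤a] : ∀ a b → a ⊓ (b + 1) ≤ a ⊓ b + 𝟙 (b + 1 ≤ᵇ a)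
a⊓[b+1]≤a⊓b+𝟙[b+1≤a] a b with b + 1 ≤ᵇ a | ≤ᵇ-reflects-≤ (b + 1) a
... | true  | ofʸ b+1≤a = ≤-reflexive (begin
  a ⊓ (b + 1)  ≡⟨ m≥n⇒m⊓n≡n b+1≤a ⟩
  b + 1        ≡⟨ cong (_+ 1) (sym (m≥n⇒m⊓n≡n (≤-trans (m≤m+n b 1) b+1≤a))) ⟩
  a ⊓ b + 1    ∎)
  where open ≡-Reasoning
... | false | ofⁿ b+1≰a = begin
  a ⊓ (b + 1)  ≤⟨ m⊓n≤m a (b + 1) ⟩
  a            ≡⟨ sym (m≤n⇒m⊓n≡m a≤b) ⟩
  a ⊓ b        ≡⟨ sym (+-identityʳ _) ⟩
  a ⊓ b + 0    ∎
  where
  open ≤-Reasoning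
  a≤b : a ≤ b
  a≤b = +-cancelʳ-≤ 1 a b (subst (_≤ b + 1) (+-comm 1 a) (≰⇒> b+1≰a))

module _ {n : ℕ} (H : Graph n) (z : Fin n) (d : Fin n → ℕ) (d+δ≡deg+1 : ∀ w → d w + δ z w ≡ deg H w + 1) where

  shifted-pivot : d z ≡ deg H z
  shifted-pivot = +-cancelʳ-≡ 1 _ _ (trans (cong (d z +_) (sym (pick-self z 1))) (d+δ≡deg+1 z))

  shifted-off : ∀ {w} → w ≢ z → d w ≡ deg H w + 1
  shifted-off {w} w≢z = trans (sym (trans (cong (d w +_) (pick-≢ 1 w≢z)) (+-identityʳ (d w)))) (d+δ≡deg+1 w)

  private
    h : Fin n → ℕ
    h = deg H

    le : Fin n → ℕ
    le j = 𝟙 (d j ≤ᵇ d z)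

    shuffle : ∀ a e → a + e + 1 ≡ a + (1 + e)
    shuffle = solve-∀

    -- Off the pivot both arguments of ⊓ drop by one; on an edge zj the minimum drops only
    -- when deg H j < deg H z, that is, when d j ≤ d z.
    pointwise : ∀ i j → adj H i j ≡ true →
      d i ⊓ d j + (δ z i + δ z j) ≤ h i ⊓ h j + (1 + (pick z i (le j) + pick z j (le i)))
    pointwise i j i~j with i ≟ᶠ z | j ≟ᶠ z
    ... | yes refl | yes refl = ⊥-elim (adj⇒≢ H i~j refl)
    ... | yes refl | no j≢z rewrite shifted-pivot | shifted-off j≢z | +-identityʳ (𝟙 (h j + 1 ≤ᵇ h i)) = begin
      h i ⊓ (h j + 1) + 1              ≤⟨ +-monoˡ-≤ 1 (a⊓[b+1]≤a⊓b+𝟙[b+1≤a] (h i) (h j)) ⟩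
      h i ⊓ h j + 𝟙 (h j + 1 ≤ᵇ h i) + 1 ≡⟨ shuffle (h i ⊓ h j) _ ⟩
      h i ⊓ h j + (1 + 𝟙 (h j + 1 ≤ᵇ h i)) ∎
      where open ≤-Reasoning
    ... | no i≢z   | yes refl rewrite shifted-pivot | shifted-off i≢z = begin
      (h i + 1) ⊓ h j + 1              ≡⟨ cong (_+ 1) (⊓-comm (h i + 1) (h j)) ⟩
      h j ⊓ (h i + 1) + 1              ≤⟨ +-monoˡ-≤ 1 (a⊓[b+1]≤a⊓b+𝟙[b+1≤a] (h j) (h i)) ⟩
      h j ⊓ h i + 𝟙 (h i + 1 ≤ᵇ h j) + 1 ≡⟨ shuffle (h j ⊓ h i) _ ⟩
      h j ⊓ h i + (1 + 𝟙 (h i + 1 ≤ᵇ h j)) ≡⟨ cong (_+ (1 + 𝟙 (h i + 1 ≤ᵇ h j))) (⊓-comm (h j) (h i)) ⟩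
      h i ⊓ h j + (1 + 𝟙 (h i + 1 ≤ᵇ h j)) ∎
      where open ≤-Reasoning
    ... | no i≢z   | no j≢z rewrite shifted-off i≢z | shifted-off j≢z =
      ≤-reflexive (trans (+-identityʳ _) (sym (+-distribʳ-⊓ 1 (h i) (h j))))


  arcSum-shifted-≤ : arcSum H (λ i j → d i ⊓ d j) + 2 * deg H z ≤ 2 * S H + 2 * edges H + 2 * nbrsAtMost H d z
  arcSum-shifted-≤ = begin
    arcSum H (λ i j → d i ⊓ d j) + 2 * h z
      ≡⟨ cong (arcSum H (λ i j → d i ⊓ d j) +_) (trans (double (h z)) (cong₂ _+_ (sym row-δ) (sym column-δ))) ⟩
    arcSum H (λ i j → d i ⊓ d j) + (arcSum H (λ i j → δ z i) + arcSum H (λ i j → δ z j))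
      ≡⟨ cong (arcSum H (λ i j → d i ⊓ d j) +_) (sym (arcSum-+ H (λ i j → δ z i) (λ i j → δ z j))) ⟩
    arcSum H (λ i j → d i ⊓ d j) + arcSum H (λ i j → δ z i + δ z j)
      ≡⟨ sym (arcSum-+ H (λ i j → d i ⊓ d j) (λ i j → δ z i + δ z j)) ⟩
    arcSum H (λ i j → d i ⊓ d j + (δ z i + δ z j))
      ≤⟨ arcSum-mono H (λ i j → pointwise i j) ⟩
    arcSum H (λ i j → h i ⊓ h j + (1 + (pick z i (le j) + pick z j (le i))))
      ≡⟨ arcSum-+ H (λ i j → h i ⊓ h j) _ ⟩
    arcSum H (λ i j → h i ⊓ h j) + arcSum H (λ i j → 1 + (pick z i (le j) + pick z j (le i)))
      ≡⟨ cong (arcSum H (λ i j → h i ⊓ h j) +_) (arcSum-+ H (λ _ _ → 1) _) ⟩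
    arcSum H (λ i j → h i ⊓ h j) + (arcSum H (λ _ _ → 1) + arcSum H (λ i j → pick z i (le j) + pick z j (le i)))
      ≡⟨ cong (λ c → arcSum H (λ i j → h i ⊓ h j) + (arcSum H (λ _ _ → 1) + c))
              (trans (arcSum-+ H (λ i j → pick z i (le j)) _) (cong₂ _+_ (arcSum-row H z le) (arcSum-column H z le))) ⟩
    arcSum H (λ i j → h i ⊓ h j) + (arcSum H (λ _ _ → 1) + (nbrSum H z le + nbrSum H z le))
      ≡⟨ cong₂ (λ a b → a + (b + (nbrSum H z le + nbrSum H z le)))
               (sym (S-double H)) (sym (arcSum-double H (λ _ _ → 1) (λ _ _ → refl))) ⟩
    2 * S H + (2 * edges H + (nbrSum H z le + nbrSum H z le))
      ≡⟨ trans (sym (+-assoc (2 * S H) _ _)) (cong (2 * S H + 2 * edges H +_) (sym (double (nbrSum H z le)))) ⟩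
    2 * S H + 2 * edges H + 2 * nbrSum H z le ∎
    where
    open ≤-Reasoning
    double : ∀ a → 2 * a ≡ a + a
    double a = cong (a +_) (+-identityʳ a)
    row-δ : arcSum H (λ i j → δ z i) ≡ h z
    row-δ = trans (arcSum-row H z (λ _ → 1)) (sym (deg≡nbrSum H z))
    column-δ : arcSum H (λ i j → δ z j) ≡ h z
    column-δ = trans (arcSum-column H z (λ _ → 1)) (sym (deg≡nbrSum H z))

  ∑-shifted : ∑[ w < n ] d w + 1 ≡ 2 * edges H + n
  ∑-shifted = begin
    ∑[ w < n ] d w + 1                     ≡⟨ cong (∑[ w < n ] d w +_) (sym (∑-δ z)) ⟩
    ∑[ w < n ] d w + ∑[ w < n ] δ z w      ≡⟨ sym (∑-distrib-+ d (δ z)) ⟩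
    ∑[ w < n ] (d w + δ z w)               ≡⟨ sum-cong-≗ d+δ≡deg+1 ⟩
    ∑[ w < n ] (h w + 1)                   ≡⟨ ∑-distrib-+ h (λ _ → 1) ⟩
    ∑[ w < n ] h w + ∑[ w < n ] 1          ≡⟨ cong₂ _+_ (sym (handshake H)) (trans (∑-const n 1) (*-identityʳ n)) ⟩
    2 * edges H + n                        ∎
    where open ≡-Reasoning

𝟙[b≤a]+a+b≤k+a⊓b : ∀ {a b k} → a < k → b ≤ k → 𝟙 (b ≤ᵇ a) + a + b ≤ k + a ⊓ b
𝟙[b≤a]+a+b≤k+a⊓b {a} {b} {k} a<k b≤k with b ≤ᵇ a | ≤ᵇ-reflects-≤ b a
... | true  | ofʸ b≤a rewrite m≥n⇒m⊓n≡n b≤a = +-monoˡ-≤ b a<k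
... | false | ofⁿ b≰a rewrite m≤n⇒m⊓n≡m (<⇒≤ (≰⇒> b≰a)) = subst (_≤ k + a) (+-comm b a) (+-monoˡ-≤ a b≤k)

rotation-arith : ∀ {s σ q a sh eh l l′ e dx dy μ k} →
  s + 2 * k + 2 * k ≤ σ + q → q + 2 * μ ≡ a + 2 * dy → a + 2 * dx ≤ sh + eh + 2 * l →
  l ≤ l′ + e → e + dx + dy ≤ k + μ → s + 4 * dx + 2 * k ≤ σ + sh + eh + 2 * l′
rotation-arith {s} {σ} {q} {a} {sh} {eh} {l} {l′} {e} {dx} {dy} {μ} {k} h₁ h₂ h₃ h₄ h₅ =
  +-cancelʳ-≤ X _ _ (subst₂ _≤_ (lhs s q a l e dx dy μ k) (rhs σ q a sh eh l l′ e dy μ k)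
    (+-mono-≤ (+-mono-≤ (+-mono-≤ (+-mono-≤ h₁ (≤-reflexive h₂)) h₃) (*-monoʳ-≤ 2 h₄)) (*-monoʳ-≤ 2 h₅)))
  where
  X : ℕ
  X = q + 2 * μ + a + 2 * l + 2 * e + 2 * dy + 2 * k
  lhs : ∀ s q a l e dx dy μ k → s + 2 * k + 2 * k + (q + 2 * μ) + (a + 2 * dx) + 2 * l + 2 * (e + dx + dy)
                                ≡ s + 4 * dx + 2 * k + (q + 2 * μ + a + 2 * l + 2 * e + 2 * dy + 2 * k)
  lhs = solve-∀
  rhs : ∀ σ q a sh eh l l′ e dy μ k → σ + q + (a + 2 * dy) + (sh + eh + 2 * l) + 2 * (l′ + e) + 2 * (k + μ)
                                      ≡ σ + sh + eh + 2 * l′ + (q + 2 * μ + a + 2 * l + 2 * e + 2 * dy + 2 * k)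
  rhs = solve-∀

final-arith : ∀ {s t dz L k m c M} →
  s + 4 * dz + 2 * k ≤ 2 * (suc k * k + 2 * m) + t + 2 * (c + m) + 2 * L →
  2 * L + 8 * m ≤ 4 * dz → 2 * c + k ≡ k * k → k * M + k ≡ 3 * (k * k) → s + 2 * m ≤ k * M + t
final-arith {s} {t} {dz} {L} {k} {m} {c} {M} h₁ h₂ h₃ h₄ =
  +-cancelʳ-≤ X _ _ (subst₂ _≤_ (lhs s t dz L k m c) (rhs s t dz L k m c M)
    (+-mono-≤ (+-mono-≤ (+-mono-≤ h₁ h₂) (≤-reflexive h₃)) (≤-reflexive (sym h₄))))
  where
  X : ℕ
  X = 4 * dz + 3 * k + 2 * L + 6 * m + 2 * c + 3 * (k * k)
  lhs : ∀ s t dz L k m c → s + 4 * dz + 2 * k + (2 * L + 8 * m) + (2 * c + k) + 3 * (k * k)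
                           ≡ s + 2 * m + (4 * dz + 3 * k + 2 * L + 6 * m + 2 * c + 3 * (k * k))
  lhs = solve-∀
  rhs : ∀ s t dz L k m c M → 2 * (suc k * k + 2 * m) + t + 2 * (c + m) + 2 * L + 4 * dz + k * k + (k * M + k)
                             ≡ k * M + t + (4 * dz + 3 * k + 2 * L + 6 * m + 2 * c + 3 * (k * k))
  rhs = solve-∀

k*[3k-1]+k≡3k² : ∀ k → 1 ≤ k → k * (3 * suc k ∸ 4) + k ≡ 3 * (k * k)
k*[3k-1]+k≡3k² (suc a) _ = begin
  suc a * (3 * suc (suc a) ∸ 4) + suc a ≡⟨ cong (λ c → suc a * (c ∸ 4) + suc a) (three-times a) ⟩
  suc a * (4 + (3 * a + 2) ∸ 4) + suc a ≡⟨ cong (λ c → suc a * c + suc a) (m+n∸m≡n 4 (3 * a + 2)) ⟩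
  suc a * (3 * a + 2) + suc a           ≡⟨ expand a ⟩
  3 * (suc a * suc a)                   ∎
  where
  open ≡-Reasoning
  three-times : ∀ a → 3 * suc (suc a) ≡ 4 + (3 * a + 2)
  three-times = solve-∀
  expand : ∀ a → suc a * (3 * a + 2) + suc a ≡ 3 * (suc a * suc a)
  expand = solve-∀

choose2-double : ∀ a → 2 * choose2 a + a ≡ a * a
choose2-double zero    = refl
choose2-double (suc a) = begin
  2 * (a + choose2 a) + suc a       ≡⟨ regroup a (choose2 a) ⟩
  2 * a + suc (2 * choose2 a + a)   ≡⟨ cong (λ c → 2 * a + suc c) (choose2-double a) ⟩
  2 * a + suc (a * a)               ≡⟨ square a ⟩
  suc a * suc a                     ∎
  where
  open ≡-Reasoning
  regroup : ∀ a c → 2 * (a + c) + suc a ≡ 2 * a + suc (2 * c + a)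
  regroup = solve-∀
  square : ∀ a → 2 * a + suc (a * a) ≡ suc a * suc a
  square = solve-∀

module Construction (k m : ℕ) (G : Graph (suc (suc k))) (edges-G : edges G ≡ choose2 (suc k) + m)
                 (noUniv : NoUniversal G) (2m<k : 2 * m < k) where

  d : Fin (suc (suc k)) → ℕ
  d = deg G

  deg≤k : ∀ w → d w ≤ k
  deg≤k w with nonUniversal⇒nonAdj G (noUniv w)
  ... | _ , j≢w , w≁j = +-cancelʳ-≤ 2 _ _ (subst (d w + 2 ≤_) (+-comm 2 k) (nonAdj⇒deg+2≤ G j≢w w≁j))

  ∑deg : ∑[ w < suc (suc k) ] d w ≡ suc k * k + 2 * m
  ∑deg = begin
    ∑[ w < suc (suc k) ] d w           ≡⟨ sym (handshake G) ⟩
    2 * edges G                        ≡⟨ cong (2 *_) edges-G ⟩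
    2 * (choose2 (suc k) + m)          ≡⟨ *-distribˡ-+ 2 (choose2 (suc k)) m ⟩
    2 * choose2 (suc k) + 2 * m        ≡⟨ cong (_+ 2 * m) (+-cancelʳ-≡ (suc k) _ _ choose2-suc) ⟩
    suc k * k + 2 * m                  ∎
    where
    open ≡-Reasoning
    choose2-suc : 2 * choose2 (suc k) + suc k ≡ suc k * k + suc k
    choose2-suc = trans (choose2-double (suc k)) (trans (*-suc (suc k) k) (+-comm (suc k) _))

  deficit : ∑[ w < suc (suc k) ] (k ∸ d w) + 2 * m ≡ k
  deficit = +-cancelˡ-≡ (suc k * k) _ _ (begin
    suc k * k + (A + 2 * m)                ≡⟨ swap (suc k * k) A (2 * m) ⟩
    A + (suc k * k + 2 * m)                ≡⟨ cong (A +_) (sym ∑deg) ⟩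
    A + ∑[ w < suc (suc k) ] d w           ≡⟨ sym (∑-distrib-+ (λ w → k ∸ d w) d) ⟩
    ∑[ w < suc (suc k) ] (k ∸ d w + d w)   ≡⟨ sum-cong-≗ (λ w → m∸n+n≡m (deg≤k w)) ⟩
    ∑[ w < suc (suc k) ] k                 ≡⟨ ∑-const (suc (suc k)) k ⟩
    suc (suc k) * k                        ≡⟨ +-comm k (suc k * k) ⟩
    suc k * k + k                          ∎)
    where
    open ≡-Reasoning
    A : ℕ
    A = ∑[ w < suc (suc k) ] (k ∸ d w)
    swap : ∀ a b c → a + (b + c) ≡ b + (a + c)
    swap = solve-∀

  nbrsAtMost+2m≤deg : ∀ z → d z < k → nbrsAtMost G d z + 2 * m ≤ d z
  nbrsAtMost+2m≤deg z dz<k = +-cancelˡ-≤ s _ _ (begin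
    s + (L + 2 * m)                        ≡⟨ sym (+-assoc s L (2 * m)) ⟩
    s + L + 2 * m                          ≤⟨ +-monoˡ-≤ (2 * m) (+-monoʳ-≤ s (m≤n*m L s)) ⟩
    s + s * L + 2 * m                      ≡⟨ cong (λ c → c + s * L + 2 * m) (sym (*-identityʳ s)) ⟩
    s * 1 + s * L + 2 * m                  ≡⟨ cong (_+ 2 * m) (sym (*-distribˡ-+ s 1 L)) ⟩
    s * (1 + L) + 2 * m                    ≤⟨ +-monoˡ-≤ (2 * m) (nbrsAtMost-deficit G d k z) ⟩
    ∑[ w < suc (suc k) ] (k ∸ d w) + 2 * m ≡⟨ deficit ⟩
    k                                      ≡⟨ sym (m∸n+n≡m (deg≤k z)) ⟩
    s + d z                                ∎)
    where
    open ≤-Reasoning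
    s : ℕ
    s = k ∸ d z
    L : ℕ
    L = nbrsAtMost G d z
    instance
      s≢0 : Data.Nat.NonZero s
      s≢0 = >-nonZero (m<n⇒0<n∸m dz<k)

  maxDegVertex : Σ (Fin (suc (suc k))) λ v → d v ≡ k
  maxDegVertex with any? (λ v → d v ≟ k)
  ... | yes found = found
  ... | no none   = ⊥-elim (<-irrefl refl (begin-strict
    k                                      <⟨ n<1+n k ⟩
    suc k                                  <⟨ n<1+n (suc k) ⟩
    suc (suc k)                            ≡⟨ sym (trans (∑-const (suc (suc k)) 1) (*-identityʳ _)) ⟩
    ∑[ w < suc (suc k) ] 1                 ≤⟨ ∑-mono-≤ (λ w → m<n⇒0<n∸m (≤∧≢⇒< (deg≤k w) (none ∘ (w ,_)))) ⟩
    ∑[ w < suc (suc k) ] (k ∸ d w)         ≤⟨ m≤m+n _ (2 * m) ⟩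
    ∑[ w < suc (suc k) ] (k ∸ d w) + 2 * m ≡⟨ deficit ⟩
    k                                      ∎))
    where open ≤-Reasoning

  Target : Set
  Target = Σ (Graph (suc k)) λ H → Admissible k m H × 2 * S G + 2 * m ≤ k * (3 * suc k ∸ 4) + 2 * S H

  module MaxDegree (v : Fin (suc (suc k))) (d-v : d v ≡ k)
               (u : Fin (suc k)) (v≁u : adj G v (punchIn v u) ≡ false) where

    p : Fin (suc k) → Fin (suc (suc k))
    p = punchIn v

    G′ : Graph (suc k)
    G′ = removeVertex G v

    d′ : Fin (suc k) → ℕ
    d′ w = d (p w)

    v-adj-all-but-u : ∀ w → 𝟙 (adj G v (p w)) + δ u w ≡ 1
    v-adj-all-but-u w with w ≟ᶠ u
    ... | yes refl rewrite v≁u = refl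
    ... | no w≢u   rewrite deg+2≡⇒uniqueNonAdj G (punchInᵢ≢i v u) v≁u (trans (cong (_+ 2) d-v) (+-comm k 2))
                             (punchInᵢ≢i v w) (w≢u ∘ punchIn-injective v w u) = refl

    d′+δ≡deg+1 : ∀ w → d′ w + δ u w ≡ deg G′ w + 1
    d′+δ≡deg+1 w = begin
      d′ w + δ u w                                   ≡⟨ cong (_+ δ u w) (deg-removeVertex G v w) ⟩
      𝟙 (adj G (p w) v) + deg G′ w + δ u w           ≡⟨ cong (λ b → 𝟙 b + deg G′ w + δ u w) (adj-sym G (p w) v) ⟩
      𝟙 (adj G v (p w)) + deg G′ w + δ u w           ≡⟨ swap (𝟙 (adj G v (p w))) (deg G′ w) (δ u w) ⟩
      deg G′ w + (𝟙 (adj G v (p w)) + δ u w)         ≡⟨ cong (deg G′ w +_) (v-adj-all-but-u w) ⟩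
      deg G′ w + 1                                   ∎
      where
      open ≡-Reasoning
      swap : ∀ a b c → a + b + c ≡ b + (a + c)
      swap = solve-∀

    S-≤-arcSum-removeVertex :
      2 * S G + 2 * d′ u + 2 * k ≤ 2 * ∑[ w < suc (suc k) ] d w + arcSum G′ (λ i j → d′ i ⊓ d′ j)
    S-≤-arcSum-removeVertex = begin
      2 * S G + 2 * d′ u + 2 * k
        ≡⟨ cong (λ c → c + 2 * d′ u + 2 * k) (trans (S-double G) (arcSum-removeVertex G v _ (λ i j → ⊓-comm (d i) (d j)))) ⟩
      2 * R + Q + 2 * d′ u + 2 * k
        ≡⟨ regroup R Q (d′ u) k ⟩
      2 * (R + d′ u + k) + Q
        ≤⟨ +-monoˡ-≤ Q (*-monoʳ-≤ 2 (+-monoˡ-≤ k (+-monoˡ-≤ (d′ u) R≤))) ⟩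
      2 * (nbrSum G v d + d′ u + k) + Q
        ≡⟨ cong (λ c → 2 * (nbrSum G v d + d′ u + c) + Q) (sym d-v) ⟩
      2 * (nbrSum G v d + d′ u + d v) + Q
        ≤⟨ +-monoˡ-≤ Q (*-monoʳ-≤ 2 (nbrSum-+-nonAdj G d (punchInᵢ≢i v u) v≁u)) ⟩
      2 * ∑[ w < suc (suc k) ] d w + Q ∎
      where
      open ≤-Reasoning
      R : ℕ
      R = nbrSum G v (λ j → d v ⊓ d j)
      Q : ℕ
      Q = arcSum G′ (λ i j → d′ i ⊓ d′ j)
      R≤ : R ≤ nbrSum G v d
      R≤ = nbrSum-mono G v (λ j _ → m⊓n≤n (d v) (d j))
      regroup : ∀ r q a b → 2 * r + q + 2 * a + 2 * b ≡ 2 * (r + a + b) + q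
      regroup = solve-∀

    record Reduced : Set where
      field
        H           : Graph (suc k)
        z           : Fin (suc k)
        d′+δ≡degH+1 : ∀ w → d′ w + δ z w ≡ deg H w + 1
        d′z<k       : d′ z < k
        S-bound     : 2 * S G + 4 * d′ z + 2 * k ≤
                      2 * ∑[ w < suc (suc k) ] d w + 2 * S H + 2 * edges H + 2 * nbrsAtMost G d (p z)

    byDeletion : d′ u < k → Reduced
    byDeletion d′u<k = record
      { H = G′ ; z = u ; d′+δ≡degH+1 = d′+δ≡deg+1 ; d′z<k = d′u<k ; S-bound = S-bound }
      where
      open ≤-Reasoning
      σ : ℕ
      σ = 2 * ∑[ w < suc (suc k) ] d w
      Q : ℕ
      Q = arcSum G′ (λ i j → d′ i ⊓ d′ j)
      S-bound : 2 * S G + 4 * d′ u + 2 * k ≤ σ + 2 * S G′ + 2 * edges G′ + 2 * nbrsAtMost G d (p u)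
      S-bound = begin
        2 * S G + 4 * d′ u + 2 * k
          ≡⟨ split (2 * S G) (d′ u) (2 * k) ⟩
        2 * S G + 2 * d′ u + 2 * k + 2 * d′ u
          ≤⟨ +-monoˡ-≤ (2 * d′ u) S-≤-arcSum-removeVertex ⟩
        σ + Q + 2 * d′ u
          ≡⟨ +-assoc σ Q _ ⟩
        σ + (Q + 2 * d′ u)
          ≡⟨ cong (λ c → σ + (Q + 2 * c)) (shifted-pivot G′ u d′ d′+δ≡deg+1) ⟩
        σ + (Q + 2 * deg G′ u)
          ≤⟨ +-monoʳ-≤ σ (arcSum-shifted-≤ G′ u d′ d′+δ≡deg+1) ⟩
        σ + (2 * S G′ + 2 * edges G′ + 2 * nbrsAtMost G′ d′ u)
          ≤⟨ +-monoʳ-≤ σ (+-monoʳ-≤ (2 * S G′ + 2 * edges G′)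
                (*-monoʳ-≤ 2 (nbrSum-removeVertex-≤ G v u (λ w → 𝟙 (d w ≤ᵇ d (p u)))))) ⟩
        σ + (2 * S G′ + 2 * edges G′ + 2 * nbrsAtMost G d (p u))
          ≡⟨ regroup σ (2 * S G′) (2 * edges G′) _ ⟩
        σ + 2 * S G′ + 2 * edges G′ + 2 * nbrsAtMost G d (p u) ∎
        where
        split : ∀ s a c → s + 4 * a + c ≡ s + 2 * a + c + 2 * a
        split = solve-∀
        regroup : ∀ a b c e → a + (b + c + e) ≡ a + b + c + e
        regroup = solve-∀

    lowVertex : Σ (Fin (suc k)) λ x → d′ x < k
    lowVertex with any? (λ w → d′ w <? k)
    ... | yes found = found
    ... | no none   = ⊥-elim (<-irrefl (trans (sym (cong (_+ 2 * m) no-deficit)) deficit) 2m<k)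
      where
      no-deficit : ∑[ w < suc (suc k) ] (k ∸ d w) ≡ 0
      no-deficit = begin
        ∑[ w < suc (suc k) ] (k ∸ d w)         ≡⟨ sum-remove {i = v} (λ w → k ∸ d w) ⟩
        k ∸ d v + ∑[ w < suc k ] (k ∸ d′ w)   ≡⟨ cong₂ _+_ (trans (cong (k ∸_) d-v) (n∸n≡0 k))
                                                   (sum-cong-≗ (λ w → m≤n⇒m∸n≡0 (≮⇒≥ (none ∘ (w ,_))))) ⟩
        0 + ∑[ w < suc k ] 0                   ≡⟨ sum-replicate-zero (suc k) ⟩
        0                                      ∎
        where open ≡-Reasoning

    -- Now u is universal in G′, so G′ itself is not admissible.
    module UniversalNonNeighbour (d′u≡k : d′ u ≡ k) {x : Fin (suc k)} (d′x<k : d′ x < k) where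

      degG′u≡k : deg G′ u ≡ k
      degG′u≡k = trans (sym (shifted-pivot G′ u d′ d′+δ≡deg+1)) d′u≡k

      u-universal : Universal G′ u
      u-universal w w≢u with adj G′ u w in u?w
      ... | true  = refl
      ... | false = ⊥-elim (1+n≰n (subst (_≤ suc k) (trans (cong (_+ 2) degG′u≡k) (+-comm k 2))
                                        (nonAdj⇒deg+2≤ G′ w≢u u?w)))

      x≢u : x ≢ u
      x≢u x≡u = <-irrefl d′u≡k (subst (λ w → d′ w < k) x≡u d′x<k)

      x-nonUniversal : ¬ Universal G′ x
      x-nonUniversal univ = <⇒≱ d′x<k (≤-trans (n≤1+n k)
        (subst (suc k ≤_) (sym (shifted-off G′ u d′ d′+δ≡deg+1 x≢u)) (universal⇒k≤deg+1 G′ univ)))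

      byRotationAt : ∀ {y} → y ≢ x → adj G′ x y ≡ false → Reduced
      byRotationAt {y} y≢x x≁y = record
        { H = H ; z = x ; d′+δ≡degH+1 = d′+δ≡degH+1 ; d′z<k = d′x<k
        ; S-bound = rotation-arith {s = 2 * S G} {σ = 2 * ∑[ w < suc (suc k) ] d w} {q = arcSum G′ f}
                      {a = arcSum H f} {sh = 2 * S H} {eh = 2 * edges H} {l = nbrsAtMost H d′ x}
                      {e = 𝟙 (d′ y ≤ᵇ d′ x)} {dx = d′ x} {dy = d′ y} {μ = d′ x ⊓ d′ y} {k = k}
                      S-≤-arcSum-G′ arcSum-rotated arcSum-H-≤ nbrsAtMost-H-≤
                      (𝟙[b≤a]+a+b≤k+a⊓b d′x<k (deg≤k (p y))) }
        where
        x≢y : x ≢ y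
        x≢y = y≢x ∘ sym

        u~y : adj G′ u y ≡ true
        u~y = u-universal y y≢u
          where
          y≢u : y ≢ u
          y≢u y≡u with trans (sym x≁y) (trans (cong (adj G′ x) y≡u) (trans (adj-sym G′ x u) (u-universal x x≢u)))
          ... | ()

        H : Graph (suc k)
        H = rotateEdge G′ y u x x≢y

        d′+δ≡degH+1 : ∀ w → d′ w + δ x w ≡ deg H w + 1
        d′+δ≡degH+1 w = +-cancelʳ-≡ (δ u w) _ _ (begin
          d′ w + δ x w + δ u w            ≡⟨ swap (d′ w) (δ x w) (δ u w) ⟩
          d′ w + δ u w + δ x w            ≡⟨ cong (_+ δ x w) (d′+δ≡deg+1 w) ⟩
          deg G′ w + 1 + δ x w            ≡⟨ swap (deg G′ w) 1 (δ x w) ⟩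
          deg G′ w + δ x w + 1            ≡⟨ cong (_+ 1) (sym (rotateEdge-deg G′ x≢y x≢u u~y x≁y w)) ⟩
          deg H w + δ u w + 1             ≡⟨ swap (deg H w) (δ u w) 1 ⟩
          deg H w + 1 + δ u w             ∎)
          where
          open ≡-Reasoning
          swap : ∀ a b c → a + b + c ≡ a + c + b
          swap = solve-∀

        f : Fin (suc k) → Fin (suc k) → ℕ
        f i j = d′ i ⊓ d′ j

        S-≤-arcSum-G′ : 2 * S G + 2 * k + 2 * k ≤ 2 * ∑[ w < suc (suc k) ] d w + arcSum G′ f
        S-≤-arcSum-G′ =
          subst (λ c → 2 * S G + 2 * c + 2 * k ≤ 2 * ∑[ w < suc (suc k) ] d w + arcSum G′ f) d′u≡k S-≤-arcSum-removeVertex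

        arcSum-rotated : arcSum G′ f + 2 * (d′ x ⊓ d′ y) ≡ arcSum H f + 2 * d′ y
        arcSum-rotated = begin
          arcSum G′ f + 2 * (d′ x ⊓ d′ y)
            ≡⟨ cong (λ c → arcSum G′ f + (d′ x ⊓ d′ y + c)) (trans (+-identityʳ _) (⊓-comm (d′ x) (d′ y))) ⟩
          arcSum G′ f + (f x y + f y x)
            ≡⟨ sym (rotateEdge-arcSum G′ x≢y x≢u u~y x≁y f) ⟩
          arcSum H f + (f u y + f y u)
            ≡⟨ cong (arcSum H f +_) (cong₂ _+_ (trans (cong (_⊓ d′ y) d′u≡k) (m≥n⇒m⊓n≡n (deg≤k (p y))))
                                               (trans (cong (d′ y ⊓_) d′u≡k) (m≤n⇒m⊓n≡m (deg≤k (p y))))) ⟩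
          arcSum H f + (d′ y + d′ y)
            ≡⟨ cong (λ c → arcSum H f + (d′ y + c)) (sym (+-identityʳ (d′ y))) ⟩
          arcSum H f + 2 * d′ y ∎
          where open ≡-Reasoning

        arcSum-H-≤ : arcSum H f + 2 * d′ x ≤ 2 * S H + 2 * edges H + 2 * nbrsAtMost H d′ x
        arcSum-H-≤ = subst (λ c → arcSum H f + 2 * c ≤ 2 * S H + 2 * edges H + 2 * nbrsAtMost H d′ x)
                           (sym (shifted-pivot H x d′ d′+δ≡degH+1)) (arcSum-shifted-≤ H x d′ d′+δ≡degH+1)

        nbrsAtMost-H-≤ : nbrsAtMost H d′ x ≤ nbrsAtMost G d (p x) + 𝟙 (d′ y ≤ᵇ d′ x)
        nbrsAtMost-H-≤ = subst (_≤ nbrsAtMost G d (p x) + 𝟙 (d′ y ≤ᵇ d′ x))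
                               (sym (rotateEdge-nbrSum-pivot G′ x≢y x≢u u~y x≁y (λ j → 𝟙 (d′ j ≤ᵇ d′ x))))
                               (+-monoˡ-≤ _ (nbrSum-removeVertex-≤ G v x (λ w → 𝟙 (d w ≤ᵇ d (p x)))))

      byRotation : Reduced
      byRotation with nonUniversal⇒nonAdj G′ x-nonUniversal
      ... | _ , y≢x , x≁y = byRotationAt y≢x x≁y

    lifted-edges : ∀ (H : Graph (suc k)) {z} → (∀ w → d′ w + δ z w ≡ deg H w + 1) → edges H ≡ choose2 k + m
    lifted-edges H {z} lift = *-cancelˡ-≡ (edges H) (choose2 k + m) 2 (+-cancelʳ-≡ (suc k + k) _ _ (begin
      2 * edges H + (suc k + k)               ≡⟨ sym (+-assoc (2 * edges H) (suc k) k) ⟩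
      2 * edges H + suc k + k                 ≡⟨ cong (_+ k) (sym (∑-shifted H z d′ lift)) ⟩
      ∑[ w < suc k ] d′ w + 1 + k             ≡⟨ swap (∑[ w < suc k ] d′ w) 1 k ⟩
      k + ∑[ w < suc k ] d′ w + 1             ≡⟨ cong (_+ 1) (trans (sym ∑d≡k+∑d′) ∑deg) ⟩
      suc k * k + 2 * m + 1                   ≡⟨ cong (λ c → k + c + 2 * m + 1) (sym (choose2-double k)) ⟩
      k + (2 * choose2 k + k) + 2 * m + 1     ≡⟨ regroup k (choose2 k) m ⟩
      2 * (choose2 k + m) + (suc k + k)       ∎))
      where
      open ≡-Reasoning
      ∑d≡k+∑d′ : ∑[ w < suc (suc k) ] d w ≡ k + ∑[ w < suc k ] d′ w
      ∑d≡k+∑d′ = trans (sum-remove {i = v} d) (cong (_+ ∑[ w < suc k ] d′ w) d-v)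
      swap : ∀ a b c → a + b + c ≡ c + a + b
      swap = solve-∀
      regroup : ∀ k c m → k + (2 * c + k) + 2 * m + 1 ≡ 2 * (c + m) + (suc k + k)
      regroup = solve-∀

    lifted-deg< : ∀ (H : Graph (suc k)) {z} → (∀ w → d′ w + δ z w ≡ deg H w + 1) → d′ z < k → ∀ w → deg H w < k
    lifted-deg< H {z} lift d′z<k w = subst (_≤ k) (trans (lift w) (+-comm (deg H w) 1)) d′+δ≤k
      where
      d′+δ≤k : d′ w + δ z w ≤ k
      d′+δ≤k with w ≟ᶠ z
      ... | yes refl = subst (_≤ k) (+-comm 1 (d′ w)) d′z<k
      ... | no _     = subst (_≤ k) (sym (+-identityʳ (d′ w))) (deg≤k (p w))

    reduced⇒target : Reduced → Target
    reduced⇒target r = H , (edges-H , deg<⇒noUniversal H (lifted-deg< H d′+δ≡degH+1 d′z<k)) ,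
      final-arith {s = 2 * S G} {t = 2 * S H} {dz = d′ z} {L = L} {k = k} {m = m} {c = choose2 k} {M = 3 * suc k ∸ 4}
        (subst₂ (λ a b → 2 * S G + 4 * d′ z + 2 * k ≤ 2 * a + 2 * S H + 2 * b + 2 * L) ∑deg edges-H S-bound)
        nbrsAtMost-bound (choose2-double k) (k*[3k-1]+k≡3k² k (≤-trans (s≤s z≤n) 2m<k))
      where
      open Reduced r
      L : ℕ
      L = nbrsAtMost G d (p z)

      edges-H : edges H ≡ choose2 k + m
      edges-H = lifted-edges H d′+δ≡degH+1

      nbrsAtMost-bound : 2 * L + 8 * m ≤ 4 * d′ z
      nbrsAtMost-bound = begin
        2 * L + 8 * m        ≤⟨ +-monoˡ-≤ (8 * m) (*-monoˡ-≤ L {2} {4} (s≤s (s≤s z≤n))) ⟩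
        4 * L + 8 * m        ≡⟨ factor L m ⟩
        4 * (L + 2 * m)      ≤⟨ *-monoʳ-≤ 4 (nbrsAtMost+2m≤deg (p z) d′z<k) ⟩
        4 * d′ z             ∎
        where
        open ≤-Reasoning
        factor : ∀ L m → 4 * L + 8 * m ≡ 4 * (L + 2 * m)
        factor = solve-∀

    target : Target
    target with d′ u <? k
    ... | yes d′u<k = reduced⇒target (byDeletion d′u<k)
    ... | no d′u≮k  =
      reduced⇒target (UniversalNonNeighbour.byRotation (≤-antisym (deg≤k (p u)) (≮⇒≥ d′u≮k)) (proj₂ lowVertex))

  theorem : Target
  theorem with maxDegVertex
  ... | v , d-v with nonUniversal⇒nonAdj G (noUniv v)
  ...   | j , j≢v , v≁j = MaxDegree.target v d-v (punchOut v≢j) (trans (cong (adj G v) (punchIn-punchOut v≢j)) v≁j)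
    where
    v≢j : v ≢ j
    v≢j = j≢v ∘ sym

lemma7 : (n m : ℕ) → 1 ≤ n → 1 ≤ m → m ≤ n → 2 * m < n ∸ 1 →
    (G : Graph (suc n)) → Admissible n m G →
    Σ (Graph (suc (n ∸ 1))) (λ H → Admissible (n ∸ 1) m H ×
      2 * S G + 2 * m ≤ (n ∸ 1) * (3 * n ∸ 4) + 2 * S H)
lemma7 zero    m () _ _ _ _ _
lemma7 (suc k) m _ _ _ 2m<k G (edges-G , noUniv) = Construction.theorem k m G edges-G noUniv 2m<k
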